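{- Let $n\ge 3$ and let $\mathcal{H}(\mathcal{V},\mathcal{E})$ be the associating hypergraph on the Moufang loop $M(D_n,2)$. Then its strong chromatic number is $\overline{\psi}(\mathcal{H})=4n$.
   Context: Let $D_n=\langle x,y\mid x^n=y^2=1,\ xy=yx^{ -1}\rangle$ be the dihedral group of order $2n$. The Moufang loop $M(D_n,2)$ is the set $\{(g,\alpha): g\in D_n,\ \alpha\in\mathbb{Z}_2\}$ (of size $4n$) with the operation $(g_1,\alpha_1)\circ(g_2,\alpha_2)=\big(g_1^{1-\alpha_2}\, g_2^{(-1)^{\alpha_1}}\, g_1^{\alpha_2},\ \alpha_1+\alpha_2\big)$, where $\alpha_i\in\{0,1\}$ are used as integer exponents. The associating hypergraph $\mathcal{H}(\mathcal{V},\mathcal{E})$ has vertex set $\mathcal{V}=M(D_n,2)$, and its hyperedges are the triples of three pairwise distinct elements $a,b,c$, taken in an order $(a,b,c)$, such that $(a\circ b)\circ c=a\circ(b\circ c)$ (a 3-uniform directed hypergraph). A strong coloring is an assignment of colors to vertices such that any two distinct vertices lying in a common hyperedge receive different colors; the strong chromatic number $\overline{\psi}(\mathcal{H})$ is the minimum number of colors in a strong coloring. -}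

module Defs where

open import Data.Nat using (ℕ; zero; suc; _+_; _∸_; _<_; _≤_; NonZero)
open import Data.Nat.DivMod using (_%_; m%n<n)
open import Data.Fin using (Fin; toℕ; fromℕ<)
open import Data.Bool using (Bool; true; false; _xor_)
open import Data.Product using (Σ; _×_; _,_; proj₁; proj₂)
open import Relation.Binary.PropositionalEquality using (_≡_)
open import Relation.Nullary using (¬_)

module _ (n : ℕ) .{{_ : NonZero n}} where

  modN : ℕ → Fin n
  modN k = fromℕ< (m%n<n k n)

  addN : Fin n → Fin n → Fin n
  addN i j = modN (toℕ i + toℕ j)

  negN : Fin n → Fin n
  negN i = modN (n ∸ toℕ i)

  -- Dihedral group D_n = ⟨x, y | x^n = y^2 = 1, xy = yx⁻¹⟩ of order 2n.
  -- The pair (i , s) stands for x^i y^s (s = false ↦ 0, s = true ↦ 1).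
  Dih : Set
  Dih = Fin n × Bool

  -- x^i y^a · x^j y^b = x^(i + (-1)^a j) y^(a+b), using y x^j = x^(-j) y.
  dmul : Dih → Dih → Dih
  dmul (i , false) (j , b) = (addN i j , b)
  dmul (i , true)  (j , b) = (addN i (negN j) , true xor b)

  dinv : Dih → Dih
  dinv (i , false) = (negN i , false)
  dinv (i , true)  = (i , true)

  did : Dih
  did = (modN 0 , false)

  -- α ∈ ℤ₂ used as an integer exponent 0 or 1.
  powB : Dih → Bool → Dih
  powB g false = did
  powB g true  = g

  powCoB : Dih → Bool → Dih
  powCoB g false = g
  powCoB g true  = did

  powSign : Dih → Bool → Dih
  powSign g false = g
  powSign g true  = dinv g

  ML : Set
  ML = Dih × Bool

  -- (g1,α1)∘(g2,α2) = (g1^(1-α2) g2^((-1)^α1) g1^α2 , α1+α2)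
  _∘_ : ML → ML → ML
  (g₁ , α₁) ∘ (g₂ , α₂) =
    (dmul (dmul (powCoB g₁ α₂) (powSign g₂ α₁)) (powB g₁ α₂) , α₁ xor α₂)

  IsHyperedge : ML → ML → ML → Set
  IsHyperedge a b c =
    ¬ a ≡ b × ¬ a ≡ c × ¬ b ≡ c × ((a ∘ b) ∘ c ≡ a ∘ (b ∘ c))

  IsStrongColoring : (k : ℕ) → (ML → Fin k) → Set
  IsStrongColoring k col =
    ∀ a b c → IsHyperedge a b c →
      ¬ col a ≡ col b × ¬ col a ≡ col c × ¬ col b ≡ col c

  StrongChromaticNumber≡ : ℕ → Set
  StrongChromaticNumber≡ m =
    (Σ (ML → Fin m) (IsStrongColoring m)) ×
    (∀ k → k < m → (col : ML → Fin k) → ¬ IsStrongColoring k col)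

-- The identity element e of a loop associates with everything, so every triple
-- (a, b, e) and (e, b, c) of pairwise distinct elements is a hyperedge.  Hence
-- any two distinct vertices lie in a common hyperedge, a strong coloring must be
-- injective, and 4n colors are necessary and (trivially) sufficient.
module Submission where

open import Defs
open import Algebra.Core using (Op₂)
open import Algebra.Definitions using (Identity)
open import Data.Bool using (Bool; true; false)
import Data.Bool.Properties as Bool
open import Data.Fin using (Fin; toℕ)
open import Data.Fin.Properties using (toℕ-fromℕ<; toℕ-injective; toℕ<n; injective⇒≤; 2↔Bool; *↔×)
import Data.Fin.Properties as Fin
open import Data.Nat using (ℕ; _+_; _∸_; _*_; _%_; _≤_; NonZero; >-nonZero⁻¹)
open import Data.Nat.DivMod using (m%n<n; m<n⇒m%n≡m; n%n≡0)
open import Data.Nat.Properties using (+-identityʳ; <⇒≱)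
open import Data.Product using (_×_; ∃-syntax; _,_; proj₁; proj₂)
open import Data.Product.Algebra using (×-cong; ×-comm; ×-assoc)
open import Data.Product.Properties using (≡-dec)
open import Function using (_∘′_; _↔_; _↣_; Injection)
open import Function.Definitions using (Injective)
open import Function.Properties.Inverse using (↔-refl; ↔-sym; ↔⇒↣)
open import Function.Related.Propositional using (module EquationalReasoning)
open import Relation.Binary.Definitions using (DecidableEquality)
open import Relation.Binary.PropositionalEquality
  using (_≡_; _≢_; refl; sym; trans; cong; module ≡-Reasoning)
open import Relation.Nullary using (yes; no)
open import Relation.Nullary.Decidable using (decidable-stable)

module _ {A : Set} (_·_ : Op₂ A) {e : A} (identity : Identity _≡_ e _·_) where

  assoc-identityʳ : ∀ a b → (a · b) · e ≡ a · (b · e)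
  assoc-identityʳ a b =
    trans (proj₂ identity (a · b)) (cong (a ·_) (sym (proj₂ identity b)))

  assoc-identityˡ : ∀ b c → (e · b) · c ≡ e · (b · c)
  assoc-identityˡ b c =
    trans (cong (_· c) (proj₁ identity b)) (sym (proj₁ identity (b · c)))

module _ (n : ℕ) .{{_ : NonZero n}} where

  private
    0F : Fin n
    0F = modN n 0

    toℕ-modN : ∀ k → toℕ (modN n k) ≡ k % n
    toℕ-modN k = toℕ-fromℕ< (m%n<n k n)

    toℕ-0F : toℕ 0F ≡ 0
    toℕ-0F = trans (toℕ-modN 0) (m<n⇒m%n≡m (>-nonZero⁻¹ n))

  negN-zero : negN n 0F ≡ 0F
  negN-zero = toℕ-injective (begin
    toℕ (modN n (n ∸ toℕ 0F)) ≡⟨ toℕ-modN _ ⟩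
    (n ∸ toℕ 0F) % n          ≡⟨ cong (λ k → (n ∸ k) % n) toℕ-0F ⟩
    n % n                     ≡⟨ n%n≡0 n ⟩
    0                         ≡⟨ toℕ-0F ⟨
    toℕ 0F                    ∎)
    where open ≡-Reasoning

  addN-identityˡ : ∀ i → addN n 0F i ≡ i
  addN-identityˡ i = toℕ-injective (begin
    toℕ (modN n (toℕ 0F + toℕ i)) ≡⟨ toℕ-modN _ ⟩
    (toℕ 0F + toℕ i) % n          ≡⟨ cong (λ k → (k + toℕ i) % n) toℕ-0F ⟩
    toℕ i % n                     ≡⟨ m<n⇒m%n≡m (toℕ<n i) ⟩
    toℕ i                         ∎)
    where open ≡-Reasoning

  addN-identityʳ : ∀ i → addN n i 0F ≡ i
  addN-identityʳ i = toℕ-injective (begin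
    toℕ (modN n (toℕ i + toℕ 0F)) ≡⟨ toℕ-modN _ ⟩
    (toℕ i + toℕ 0F) % n          ≡⟨ cong (λ k → (toℕ i + k) % n) toℕ-0F ⟩
    (toℕ i + 0) % n               ≡⟨ cong (_% n) (+-identityʳ (toℕ i)) ⟩
    toℕ i % n                     ≡⟨ m<n⇒m%n≡m (toℕ<n i) ⟩
    toℕ i                         ∎)
    where open ≡-Reasoning

  dmul-identityˡ : ∀ g → dmul n (did n) g ≡ g
  dmul-identityˡ (j , b) = cong (_, b) (addN-identityˡ j)

  dmul-identityʳ : ∀ g → dmul n g (did n) ≡ g
  dmul-identityʳ (i , false) = cong (_, false) (addN-identityʳ i)
  dmul-identityʳ (i , true)  =
    cong (_, true) (trans (cong (addN n i) negN-zero) (addN-identityʳ i))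

  dinv-identity : dinv n (did n) ≡ did n
  dinv-identity = cong (_, false) negN-zero

  ε : ML n
  ε = (did n , false)

  ∘-identity : Identity _≡_ ε (_∘_ n)
  ∘-identity = identityˡ , identityʳ
    where
    identityˡ : ∀ a → _∘_ n ε a ≡ a
    identityˡ (g , false) = cong (_, false) (trans (dmul-identityʳ _) (dmul-identityˡ g))
    identityˡ (g , true)  = cong (_, true)  (trans (dmul-identityʳ _) (dmul-identityˡ g))

    identityʳ : ∀ a → _∘_ n a ε ≡ a
    identityʳ (g , false) = cong (_, false) (trans (dmul-identityʳ _) (dmul-identityʳ g))
    identityʳ (g , true)  = cong (_, true)
      (trans (dmul-identityʳ _) (trans (cong (dmul n g) dinv-identity) (dmul-identityʳ g)))

  _≟_ : DecidableEquality (ML n)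
  _≟_ = ≡-dec (≡-dec Fin._≟_ Bool._≟_) Bool._≟_

  ML↔Fin : ML n ↔ Fin (4 * n)
  ML↔Fin = begin
    ((Fin n × Bool) × Bool)    ↔⟨ ×-cong (×-cong ↔-refl 2↔Bool) 2↔Bool ⟨
    ((Fin n × Fin 2) × Fin 2)  ↔⟨ ×-assoc _ _ _ _ ⟩
    (Fin n × (Fin 2 × Fin 2))  ↔⟨ ×-cong ↔-refl (*↔× {2} {2}) ⟨
    (Fin n × Fin 4)            ↔⟨ ×-comm _ _ ⟩
    (Fin 4 × Fin n)            ↔⟨ *↔× {4} {n} ⟨
    Fin (4 * n)                ∎
    where open EquationalReasoning

  private
    c₁ c₂ : ML n
    c₁ = (did n , true)
    c₂ = ((0F , true) , true)

  identity-inHyperedge : ∀ b → b ≢ ε → ∃[ c ] IsHyperedge n ε b c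
  identity-inHyperedge b b≢ε with b ≟ c₁
  ... | yes refl = c₂ , (λ ()) , (λ ()) , (λ ()) ,
                   assoc-identityˡ (_∘_ n) ∘-identity b c₂
  ... | no b≢c₁  = c₁ , (λ ε≡b → b≢ε (sym ε≡b)) , (λ ()) , b≢c₁ ,
                   assoc-identityˡ (_∘_ n) ∘-identity b c₁

  module _ {k : ℕ} {col : ML n → Fin k} (strong : IsStrongColoring n k col) where

    private
      separates-ε : ∀ b → b ≢ ε → col ε ≢ col b
      separates-ε b b≢ε with identity-inHyperedge b b≢ε
      ... | c , hyperedge = proj₁ (strong ε b c hyperedge)

    strongColoring-separates : ∀ {a b} → a ≢ b → col a ≢ col b
    strongColoring-separates {a} {b} a≢b with a ≟ ε | b ≟ ε
    ... | yes refl | yes refl = λ _ → a≢b refl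
    ... | yes refl | no b≢ε   = separates-ε b b≢ε
    ... | no a≢ε   | yes refl = λ eq → separates-ε a a≢ε (sym eq)
    ... | no a≢ε   | no b≢ε   =
      proj₁ (strong a b ε (a≢b , a≢ε , b≢ε , assoc-identityʳ (_∘_ n) ∘-identity a b))

    strongColoring-injective : Injective _≡_ _≡_ col
    strongColoring-injective {a} {b} eq =
      decidable-stable (a ≟ b) (λ a≢b → strongColoring-separates a≢b eq)

    strongColoring-≥ : 4 * n ≤ k
    strongColoring-≥ = injective⇒≤ (λ eq →
      Injection.injective (↔⇒↣ (↔-sym ML↔Fin)) (strongColoring-injective eq))

  injective⇒strongColoring : ∀ {k} {col : ML n → Fin k} →
                             Injective _≡_ _≡_ col → IsStrongColoring n k col
  injective⇒strongColoring inj a b c (a≢b , a≢c , b≢c , _) =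
    a≢b ∘′ inj , a≢c ∘′ inj , b≢c ∘′ inj

theorem4p9 : (n : ℕ) .{{_ : NonZero n}} → 3 ≤ n →
    StrongChromaticNumber≡ n (4 * n)
theorem4p9 n _ =
  (Injection.to ML↣Fin , injective⇒strongColoring n (Injection.injective ML↣Fin)) ,
  λ k k<4n col strong → <⇒≱ k<4n (strongColoring-≥ n strong)
  where
  ML↣Fin : ML n ↣ Fin (4 * n)
  ML↣Fin = ↔⇒↣ (ML↔Fin n)
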